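{- Let $G$ and $H$ be connected graphs with roots $R_G\subseteq G$ and $R_H\subseteq H$, and let $d_{R_G}=d(R_G,Res(G,R_G))$, $d_{R_H}=d(R_H,Res(H,R_H))$. Then \[Res(G\boxtimes H,\;R_G\boxtimes R_H)\cong\begin{cases} H\boxtimes Res(G,R_G), & \text{if } d_{R_G}>d_{R_H};\\ G\boxtimes Res(H,R_H), & \text{if } d_{R_G}<d_{R_H};\\ \left\langle V(Res(G,R_G))\times V(H)\;\cup\;V(G)\times V(Res(H,R_H))\right\rangle, & \text{if } d_{R_G}=d_{R_H},\end{cases}\] where in the last case the induced subgraph is taken in $G\boxtimes H$.
   Context: A root of a connected finite graph $G$ is an induced subgraph $R_G=\langle V_0\rangle$ on a nonempty vertex set $V_0$; with $V_i$ the set of vertices at distance exactly $i$ from $V_0$ and $r$ the largest $i$ with $V_i\ne\emptyset$, the distance-residual graph is $Res(G,R_G)=\langle V_r\rangle$, and $d_{R_G}=d(R_G,Res(G,R_G))=r$ (distance between subgraphs is the minimum distance between their vertices). $G\boxtimes H$ is the strong product: vertex set $V(G)\times V(H)$, with $(u,x)\sim(v,y)$ iff ($u=v$ and $xy\in E(H)$), or ($x=y$ and $uv\in E(G)$), or ($uv\in E(G)$ and $xy\in E(H)$). $R_G\boxtimes R_H$ is the subgraph induced on $V(R_G)\times V(R_H)$. -}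

module Defs where

open import Data.Nat using (ℕ; suc; _<_; _≤_)
open import Data.Bool using (Bool; T; _∧_; _∨_)
open import Data.List using (List)
open import Data.List.Membership.Propositional using (_∈_)
open import Data.Product using (Σ; ∃-syntax; _×_; _,_)
open import Data.Sum using (_⊎_; inj₁; inj₂)
open import Function using (_∘_; _⤖_; Bijection)
open import Relation.Nullary using (¬_)
open import Relation.Binary.PropositionalEquality using (_≡_; refl)

record Graph : Set₁ where
  field
    V      : Set
    Adj    : V → V → Set
    sym    : ∀ {u v} → Adj u v → Adj v u
    irrefl : ∀ {v} → ¬ Adj v v
open Graph public

Finite : Graph → Set
Finite G = ∃[ xs ] (∀ (v : V G) → v ∈ xs)

-- Reach G S k v : the distance from the vertex set S to v is at most k.
data Reach (G : Graph) (S : V G → Set) : ℕ → V G → Set where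
  here : ∀ {k v} → S v → Reach G S k v
  step : ∀ {k u v} → Reach G S k u → Adj G u v → Reach G S (suc k) v

Connected : Graph → Set
Connected G = ∀ (u v : V G) → ∃[ k ] Reach G (_≡ u) k v

NonEmpty : {A : Set} → (A → Bool) → Set
NonEmpty {A} p = ∃[ a ] T (p a)

-- v ∈ V_i : distance from the root set V₀ to v is exactly i.
AtDist : (G : Graph) → (V G → Bool) → ℕ → V G → Set
AtDist G r i v = Reach G (T ∘ r) i v × (∀ j → j < i → ¬ Reach G (T ∘ r) j v)

-- d is the largest i with V_i nonempty (d = d_{R} = d(R, Res(G,R))).
IsResDist : (G : Graph) → (V G → Bool) → ℕ → Set
IsResDist G r d = (∃[ v ] AtDist G r d v) × (∀ i v → AtDist G r i v → i ≤ d)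

-- res is the characteristic function of V_d.
IsResSet : (G : Graph) → (V G → Bool) → ℕ → (V G → Bool) → Set
IsResSet G r d res = ∀ v → (T (res v) → AtDist G r d v) × (AtDist G r d v → T (res v))

Induced : (G : Graph) → (V G → Bool) → Graph
Induced G p = record
  { V = Σ (V G) (T ∘ p)
  ; Adj = λ { (u , _) (v , _) → Adj G u v }
  ; sym = sym G
  ; irrefl = irrefl G
  }

_⊠_ : Graph → Graph → Graph
G ⊠ H = record
  { V = V G × V H
  ; Adj = A
  ; sym = s
  ; irrefl = i
  }
  where
  A : V G × V H → V G × V H → Set
  A (u , x) (v , y) = (u ≡ v × Adj H x y) ⊎ (x ≡ y × Adj G u v) ⊎ (Adj G u v × Adj H x y)
  s : ∀ {a b} → A a b → A b a
  s (inj₁ (refl , e)) = inj₁ (refl , sym H e)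
  s (inj₂ (inj₁ (refl , e))) = inj₂ (inj₁ (refl , sym G e))
  s (inj₂ (inj₂ (e , f))) = inj₂ (inj₂ (sym G e , sym H f))
  i : ∀ {a} → ¬ A a a
  i (inj₁ (_ , e)) = irrefl H e
  i (inj₂ (inj₁ (_ , e))) = irrefl G e
  i (inj₂ (inj₂ (e , _))) = irrefl G e

_⊠ᵣ_ : {G H : Graph} → (V G → Bool) → (V H → Bool) → V (G ⊠ H) → Bool
(rG ⊠ᵣ rH) (u , x) = rG u ∧ rH x

record _≅_ (G H : Graph) : Set where
  field
    bij  : V G ⤖ V H
  open Bijection bij public using (to)
  field
    pres : ∀ u v → (Adj G u v → Adj H (to u) (to v)) × (Adj H (to u) (to v) → Adj G u v)

_∪ᵣ_ : {G H : Graph} → (V G → Bool) → (V H → Bool) → V (G ⊠ H) → Bool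
(pG ∪ᵣ pH) (u , x) = pG u ∨ pH x

{-# OPTIONS --safe #-}
module Submission where

-- In G ⊠ H a walk projects to walks in both factors, and two walks in the
-- factors run in parallel (the shorter one waiting), so the distance from
-- R_G × R_H to (u , x) is the maximum of the distances from R_G to u and from
-- R_H to x.  Hence d = dG ⊔ dH, and (u , x) is at distance d exactly when a
-- coordinate realising the maximum lies in its residual set, the other
-- coordinate being arbitrary.  Reach is not decidable, so exact distances
-- exist only under double negation; that suffices because membership in the
-- Bool-valued residual sets is decidable, hence stable.

open import Defs hiding (sym)
open import Data.Nat using (ℕ; suc; _<_; _≤_; _⊔_; _≤?_; s≤s)
open import Data.Nat.Properties
  using (<-cmp; ≤-antisym; ≤-trans; n≤1+n; m≤m⊔n; m≤n⊔m; ⊔-sel; m≥n⇒m⊔n≡m; m≤n⇒m⊔n≡n; <⇒≤; <⇒≱; ≤-reflexive)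
open import Data.Nat.Induction using (<-rec)
open import Data.Bool using (Bool; T; _∨_)
open import Data.Bool.Properties using (T-∧; T-∨; T-irrelevant; T?)
open import Data.Product using (Σ; ∃-syntax; _×_; _,_; proj₁; proj₂)
import Data.Product as Product
open import Data.Sum using (_⊎_; inj₁; inj₂; [_,_]′)
import Data.Sum as Sum
open import Data.Empty using (⊥-elim)
open import Function using (_∘_; id; _⇔_; mk⇔; Equivalence)
open import Function.Bundles using (mk↔ₛ′)
open import Function.Properties.Inverse using (↔⇒⤖)
open import Relation.Binary.Definitions using (tri<; tri≈; tri>)
open import Relation.Nullary using (¬_)
open import Relation.Nullary.Decidable using (decidable-stable)
open import Relation.Binary.PropositionalEquality
  using (_≡_; refl; sym; trans; cong; subst)

Reach-mono : ∀ {G S k m v} → k ≤ m → Reach G S k v → Reach G S m v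
Reach-mono _         (here s)   = here s
Reach-mono (s≤s k≤m) (step r e) = step (Reach-mono k≤m r) e

Reach-⊆ : ∀ {G S S′ k v} → (∀ {w} → S w → S′ w) → Reach G S k v → Reach G S′ k v
Reach-⊆ S⊆S′ (here s)   = here (S⊆S′ s)
Reach-⊆ S⊆S′ (step r e) = step (Reach-⊆ S⊆S′ r) e

AtDist-unique : ∀ {G r i j v} → AtDist G r i v → AtDist G r j v → i ≡ j
AtDist-unique {i = i} {j} (ri , minI) (rj , minJ) with <-cmp i j
... | tri< i<j _ _ = ⊥-elim (minJ i i<j ri)
... | tri≈ _ i≡j _ = i≡j
... | tri> _ _ j<i = ⊥-elim (minI j j<i rj)

IsResDist-unique : ∀ {G r d d′} → IsResDist G r d → IsResDist G r d′ → d ≡ d′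
IsResDist-unique ((v , at) , bound) ((v′ , at′) , bound′) =
  ≤-antisym (bound′ _ v at) (bound _ v′ at′)

-- The least-number principle: were there no least k, strong induction would refute every k.
Reach⇒¬¬AtDist : ∀ {G r k v} → Reach G (T ∘ r) k v → ¬ ¬ (∃[ i ] AtDist G r i v)
Reach⇒¬¬AtDist {G} {r} {k} {v} =
  <-rec (λ k → Reach G (T ∘ r) k v → ¬ ¬ (∃[ i ] AtDist G r i v)) least k
  where
  least : ∀ k → (∀ {j} → j < k → Reach G (T ∘ r) j v → ¬ ¬ (∃[ i ] AtDist G r i v)) →
          Reach G (T ∘ r) k v → ¬ ¬ (∃[ i ] AtDist G r i v)
  least k below rk noDist = noDist (k , rk , λ j j<k rj → below j<k rj noDist)

Connected⇒¬¬AtDist : ∀ {G r} → Connected G → NonEmpty r → ∀ v → ¬ ¬ (∃[ i ] AtDist G r i v)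
Connected⇒¬¬AtDist c (a , ta) v = Reach⇒¬¬AtDist (Reach-⊆ (λ { refl → ta }) (proj₂ (c a v)))

module StrongProduct (G H : Graph) (rG : V G → Bool) (rH : V H → Bool) where

  R : V (G ⊠ H) → Bool
  R = _⊠ᵣ_ {G} {H} rG rH

  Reach-proj₁ : ∀ {k u x} → Reach (G ⊠ H) (T ∘ R) k (u , x) → Reach G (T ∘ rG) k u
  Reach-proj₁ (here t)                        = here (proj₁ (Equivalence.to T-∧ t))
  Reach-proj₁ (step r (inj₁ (refl , _)))      = Reach-mono (n≤1+n _) (Reach-proj₁ r)
  Reach-proj₁ (step r (inj₂ (inj₁ (_ , e))))  = step (Reach-proj₁ r) e
  Reach-proj₁ (step r (inj₂ (inj₂ (e , _))))  = step (Reach-proj₁ r) e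

  Reach-proj₂ : ∀ {k u x} → Reach (G ⊠ H) (T ∘ R) k (u , x) → Reach H (T ∘ rH) k x
  Reach-proj₂ (here t)                        = here (proj₂ (Equivalence.to T-∧ t))
  Reach-proj₂ (step r (inj₁ (_ , f)))         = step (Reach-proj₂ r) f
  Reach-proj₂ (step r (inj₂ (inj₁ (refl , _)))) = Reach-mono (n≤1+n _) (Reach-proj₂ r)
  Reach-proj₂ (step r (inj₂ (inj₂ (_ , f))))  = step (Reach-proj₂ r) f

  Reach-pair : ∀ {k u x} → Reach G (T ∘ rG) k u → Reach H (T ∘ rH) k x →
               Reach (G ⊠ H) (T ∘ R) k (u , x)
  Reach-pair (here s)   (here t)   = here (Equivalence.from T-∧ (s , t))
  Reach-pair (here s)   (step r f) = step (Reach-pair (here s) r) (inj₁ (refl , f))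
  Reach-pair (step r e) (here t)   = step (Reach-pair r (here t)) (inj₂ (inj₁ (refl , e)))
  Reach-pair (step r e) (step q f) = step (Reach-pair r q) (inj₂ (inj₂ (e , f)))

  AtDist-pair : ∀ {a b u x} → AtDist G rG a u → AtDist H rH b x → AtDist (G ⊠ H) R (a ⊔ b) (u , x)
  AtDist-pair {a} {b} (ra , minA) (rb , minB) =
    Reach-pair (Reach-mono (m≤m⊔n a b) ra) (Reach-mono (m≤n⊔m a b) rb) , below
    where
    below : ∀ j → j < a ⊔ b → ¬ Reach (G ⊠ H) (T ∘ R) j _
    below j j<a⊔b rj with ⊔-sel a b
    ... | inj₁ a⊔b≡a = minA j (subst (j <_) a⊔b≡a j<a⊔b) (Reach-proj₁ rj)
    ... | inj₂ a⊔b≡b = minB j (subst (j <_) a⊔b≡b j<a⊔b) (Reach-proj₂ rj)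

  AtDist-⊠⇒¬¬AtDist-proj : ∀ {n u x} → AtDist (G ⊠ H) R n (u , x) →
    ¬ ¬ (AtDist G rG n u ⊎ AtDist H rH n x)
  AtDist-⊠⇒¬¬AtDist-proj {n} {u} {x} at@(rn , _) noProj =
    Reach⇒¬¬AtDist (Reach-proj₁ rn) λ (a , atA) →
    Reach⇒¬¬AtDist (Reach-proj₂ rn) λ (b , atB) →
    noProj (attained (AtDist-unique at (AtDist-pair atA atB)) atA atB)
    where
    attained : ∀ {a b} → n ≡ a ⊔ b → AtDist G rG a u → AtDist H rH b x →
               AtDist G rG n u ⊎ AtDist H rH n x
    attained {a} {b} n≡a⊔b atA atB with ⊔-sel a b
    ... | inj₁ a⊔b≡a = inj₁ (subst (λ i → AtDist G rG i u) (sym (trans n≡a⊔b a⊔b≡a)) atA)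
    ... | inj₂ a⊔b≡b = inj₂ (subst (λ i → AtDist H rH i x) (sym (trans n≡a⊔b a⊔b≡b)) atB)

  IsResDist-⊠ : ∀ {dG dH} → IsResDist G rG dG → IsResDist H rH dH → IsResDist (G ⊠ H) R (dG ⊔ dH)
  IsResDist-⊠ {dG} {dH} ((u , atU) , boundG) ((x , atX) , boundH) =
    ((u , x) , AtDist-pair atU atX) , bound
    where
    bound : ∀ n w → AtDist (G ⊠ H) R n w → n ≤ dG ⊔ dH
    bound n (u , x) at = decidable-stable (n ≤? dG ⊔ dH) λ n≰ →
      AtDist-⊠⇒¬¬AtDist-proj at λ
        { (inj₁ atU) → n≰ (≤-trans (boundG n u atU) (m≤m⊔n dG dH))
        ; (inj₂ atX) → n≰ (≤-trans (boundH n x atX) (m≤n⊔m dG dH)) }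

Σ-T-≡ : ∀ {A : Set} {p : A → Bool} {a b : A} {s : T (p a)} {t : T (p b)} →
        a ≡ b → _≡_ {A = Σ A (T ∘ p)} (a , s) (b , t)
Σ-T-≡ refl = cong (_ ,_) (T-irrelevant _ _)

mk≅ : ∀ {G H} (f : V G → V H) (g : V H → V G) → (∀ y → f (g y) ≡ y) → (∀ v → g (f v) ≡ v) →
      (∀ v w → Adj G v w ⇔ Adj H (f v) (f w)) → G ≅ H
mk≅ f g fg gf pres = record
  { bij  = ↔⇒⤖ (mk↔ₛ′ f g fg gf)
  ; pres = λ v w → Equivalence.to (pres v w) , Equivalence.from (pres v w)
  }

Induced-cong : ∀ {G p q} → (∀ v → T (p v) ⇔ T (q v)) → Induced G p ≅ Induced G q
Induced-cong p⇔q = mk≅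
  (λ (v , t) → v , Equivalence.to (p⇔q v) t)
  (λ (v , t) → v , Equivalence.from (p⇔q v) t)
  (λ _ → Σ-T-≡ refl) (λ _ → Σ-T-≡ refl) (λ _ _ → mk⇔ id id)

Induced-⊠-proj₁ : ∀ {G H} {p : V (G ⊠ H) → Bool} {q : V G → Bool} →
  (∀ u x → T (p (u , x)) ⇔ T (q u)) → Induced (G ⊠ H) p ≅ (H ⊠ Induced G q)
Induced-⊠-proj₁ {G} {H} {p} {q} p⇔q = mk≅ f g (λ _ → cong (_ ,_) (Σ-T-≡ refl)) (λ _ → Σ-T-≡ refl) pres
  where
  f : V (Induced (G ⊠ H) p) → V (H ⊠ Induced G q)
  f ((u , x) , t) = x , u , Equivalence.to (p⇔q u x) t
  g : V (H ⊠ Induced G q) → V (Induced (G ⊠ H) p)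
  g (x , u , t) = (u , x) , Equivalence.from (p⇔q u x) t
  pres : ∀ v w → Adj (Induced (G ⊠ H) p) v w ⇔ Adj (H ⊠ Induced G q) (f v) (f w)
  pres _ _ = mk⇔ to from
    where
    to : ∀ {v w} → Adj (Induced (G ⊠ H) p) v w → Adj (H ⊠ Induced G q) (f v) (f w)
    to (inj₁ (u≡v , h))          = inj₂ (inj₁ (Σ-T-≡ u≡v , h))
    to (inj₂ (inj₁ x≡y×e))       = inj₁ x≡y×e
    to (inj₂ (inj₂ (e , h)))     = inj₂ (inj₂ (h , e))
    from : ∀ {v w} → Adj (H ⊠ Induced G q) (f v) (f w) → Adj (Induced (G ⊠ H) p) v w
    from (inj₁ x≡y×e)            = inj₂ (inj₁ x≡y×e)
    from (inj₂ (inj₁ (u≡v , h))) = inj₁ (cong proj₁ u≡v , h)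
    from (inj₂ (inj₂ (h , e)))   = inj₂ (inj₂ (e , h))

Induced-⊠-proj₂ : ∀ {G H} {p : V (G ⊠ H) → Bool} {q : V H → Bool} →
  (∀ u x → T (p (u , x)) ⇔ T (q x)) → Induced (G ⊠ H) p ≅ (G ⊠ Induced H q)
Induced-⊠-proj₂ {G} {H} {p} {q} p⇔q = mk≅ f g (λ _ → cong (_ ,_) (Σ-T-≡ refl)) (λ _ → Σ-T-≡ refl)
  (λ _ _ → mk⇔ (Sum.map₂ (Sum.map₁ (Product.map₁ Σ-T-≡)))
                (Sum.map₂ (Sum.map₁ (Product.map₁ (cong proj₁)))))
  where
  f : V (Induced (G ⊠ H) p) → V (G ⊠ Induced H q)
  f ((u , x) , t) = u , x , Equivalence.to (p⇔q u x) t
  g : V (G ⊠ Induced H q) → V (Induced (G ⊠ H) p)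
  g (u , x , t) = (u , x) , Equivalence.from (p⇔q u x) t

module Residual (G H : Graph) (cG : Connected G) (cH : Connected H)
  {rG : V G → Bool} {rH : V H → Bool} (neG : NonEmpty rG) (neH : NonEmpty rH)
  {dG dH d : ℕ} {resG : V G → Bool} {resH : V H → Bool} {res : V (G ⊠ H) → Bool}
  (IG : IsResDist G rG dG) (SG : IsResSet G rG dG resG)
  (IH : IsResDist H rH dH) (SH : IsResSet H rH dH resH)
  (IP : IsResDist (G ⊠ H) (_⊠ᵣ_ {G} {H} rG rH) d)
  (SP : IsResSet (G ⊠ H) (_⊠ᵣ_ {G} {H} rG rH) d res)
  where

  open StrongProduct G H rG rH

  d≡dG⊔dH : d ≡ dG ⊔ dH
  d≡dG⊔dH = IsResDist-unique IP (IsResDist-⊠ IG IH)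

  d≡dG : dH ≤ dG → d ≡ dG
  d≡dG dH≤dG = trans d≡dG⊔dH (m≥n⇒m⊔n≡m dH≤dG)

  d≡dH : dG ≤ dH → d ≡ dH
  d≡dH dG≤dH = trans d≡dG⊔dH (m≤n⇒m⊔n≡n dG≤dH)

  res⇒¬¬AtDist-proj : ∀ {u x} → T (res (u , x)) → ¬ ¬ (AtDist G rG d u ⊎ AtDist H rH d x)
  res⇒¬¬AtDist-proj = AtDist-⊠⇒¬¬AtDist-proj ∘ proj₁ (SP _)

  resG⇒res : ∀ {u x} → dH ≤ dG → T (resG u) → T (res (u , x))
  resG⇒res {u} {x} dH≤dG t = decidable-stable (T? _) λ ¬res →
    Connected⇒¬¬AtDist cH neH x λ (b , atB) →
    ¬res (proj₂ (SP (u , x)) (subst (λ i → AtDist (G ⊠ H) R i (u , x)) (dG⊔b≡d (proj₂ IH b x atB))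
                                    (AtDist-pair (proj₁ (SG u) t) atB)))
    where
    dG⊔b≡d : ∀ {b} → b ≤ dH → dG ⊔ b ≡ d
    dG⊔b≡d b≤dH = trans (m≥n⇒m⊔n≡m (≤-trans b≤dH dH≤dG)) (sym (d≡dG dH≤dG))

  resH⇒res : ∀ {u x} → dG ≤ dH → T (resH x) → T (res (u , x))
  resH⇒res {u} {x} dG≤dH t = decidable-stable (T? _) λ ¬res →
    Connected⇒¬¬AtDist cG neG u λ (a , atA) →
    ¬res (proj₂ (SP (u , x)) (subst (λ i → AtDist (G ⊠ H) R i (u , x)) (a⊔dH≡d (proj₂ IG a u atA))
                                    (AtDist-pair atA (proj₁ (SH x) t))))
    where
    a⊔dH≡d : ∀ {a} → a ≤ dG → a ⊔ dH ≡ d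
    a⊔dH≡d a≤dG = trans (m≤n⇒m⊔n≡n (≤-trans a≤dG dG≤dH)) (sym (d≡dH dG≤dH))

  AtDist⇒resG : ∀ {u} → dH ≤ dG → AtDist G rG d u → T (resG u)
  AtDist⇒resG {u} dH≤dG at = proj₂ (SG u) (subst (λ i → AtDist G rG i u) (d≡dG dH≤dG) at)

  AtDist⇒resH : ∀ {x} → dG ≤ dH → AtDist H rH d x → T (resH x)
  AtDist⇒resH {x} dG≤dH at = proj₂ (SH x) (subst (λ i → AtDist H rH i x) (d≡dH dG≤dH) at)

  res⇔resG : dH < dG → ∀ u x → T (res (u , x)) ⇔ T (resG u)
  res⇔resG dH<dG u x = mk⇔ res⇒resG (resG⇒res (<⇒≤ dH<dG))
    where
    res⇒resG : T (res (u , x)) → T (resG u)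
    res⇒resG t = decidable-stable (T? _) λ ¬resG → res⇒¬¬AtDist-proj t λ
      { (inj₁ atU) → ¬resG (AtDist⇒resG (<⇒≤ dH<dG) atU)
      ; (inj₂ atX) → <⇒≱ dH<dG (subst (_≤ dH) (d≡dG (<⇒≤ dH<dG)) (proj₂ IH d x atX)) }

  res⇔resH : dG < dH → ∀ u x → T (res (u , x)) ⇔ T (resH x)
  res⇔resH dG<dH u x = mk⇔ res⇒resH (resH⇒res (<⇒≤ dG<dH))
    where
    res⇒resH : T (res (u , x)) → T (resH x)
    res⇒resH t = decidable-stable (T? _) λ ¬resH → res⇒¬¬AtDist-proj t λ
      { (inj₁ atU) → <⇒≱ dG<dH (subst (_≤ dG) (d≡dH (<⇒≤ dG<dH)) (proj₂ IG d u atU))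
      ; (inj₂ atX) → ¬resH (AtDist⇒resH (<⇒≤ dG<dH) atX) }

  res⇔resG∨resH : dG ≡ dH → ∀ u x → T (res (u , x)) ⇔ T (resG u ∨ resH x)
  res⇔resG∨resH dG≡dH u x = mk⇔ res⇒resG∨resH (resG∨resH⇒res ∘ Equivalence.to T-∨)
    where
    dH≤dG : dH ≤ dG
    dH≤dG = ≤-reflexive (sym dG≡dH)
    dG≤dH : dG ≤ dH
    dG≤dH = ≤-reflexive dG≡dH
    res⇒resG∨resH : T (res (u , x)) → T (resG u ∨ resH x)
    res⇒resG∨resH t = decidable-stable (T? _) λ ¬resG∨resH → res⇒¬¬AtDist-proj t
      (¬resG∨resH ∘ Equivalence.from T-∨ ∘ Sum.map (AtDist⇒resG dH≤dG) (AtDist⇒resH dG≤dH))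
    resG∨resH⇒res : T (resG u) ⊎ T (resH x) → T (res (u , x))
    resG∨resH⇒res = [ resG⇒res dH≤dG , resH⇒res dG≤dH ]′

theorem4 : (G H : Graph) → Finite G → Finite H → Connected G → Connected H →
    (rG : V G → Bool) (rH : V H → Bool) → NonEmpty rG → NonEmpty rH →
    (dG dH d : ℕ) (resG : V G → Bool) (resH : V H → Bool) (res : V (G ⊠ H) → Bool) →
    IsResDist G rG dG → IsResSet G rG dG resG →
    IsResDist H rH dH → IsResSet H rH dH resH →
    IsResDist (G ⊠ H) (_⊠ᵣ_ {G} {H} rG rH) d → IsResSet (G ⊠ H) (_⊠ᵣ_ {G} {H} rG rH) d res →
    (dH < dG → Induced (G ⊠ H) res ≅ (H ⊠ Induced G resG))
    × (dG < dH → Induced (G ⊠ H) res ≅ (G ⊠ Induced H resH))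
    × (dG ≡ dH → Induced (G ⊠ H) res ≅ Induced (G ⊠ H) (_∪ᵣ_ {G} {H} resG resH))
theorem4 G H _ _ cG cH _ _ neG neH _ _ _ _ _ _ IG SG IH SH IP SP =
    Induced-⊠-proj₁ ∘ res⇔resG
  , Induced-⊠-proj₂ ∘ res⇔resH
  , λ dG≡dH → Induced-cong (λ (u , x) → res⇔resG∨resH dG≡dH u x)
  where open Residual G H cG cH neG neH IG SG IH SH IP SP
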